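{- For every positive integer $m$, \[ \mathrm{Lift}\big(\mathcal{IP}^{(m)}\big)=\Psi\big(\mathcal{IL}^m(2)\big). \]
   Context: Permutations of $[n]$ are bijections $[n]\to[n]$, composed as maps. A permutation $\sigma$ of $[n]$ has $m$ indecomposable parts if $m$ is the largest number such that $[n]$ is a disjoint union of $m$ nonempty intervals of consecutive integers $I_1,\dots,I_m$ with $\sigma(I_j)=I_j$ for all $j$; $\mathcal{IP}^{(m)}$ is the set of all permutations (of all sizes) with exactly $m$ indecomposable parts. A linear order on $[n]$ is written $\ell=(\ell_1<\dots<\ell_n)$ with associated permutation $\pi_\ell:i\mapsto\ell_i$; $\mathcal L_n$ is the set of linear orders on $[n]$. A $2$-multiple linear order on $[n]$ is a pair $(\ell,\hat\ell)$ of linear orders on $[n]$; its number of irreducible parts is the largest $m$ such that $[n]$ admits a partition into nonempty blocks $I_1,\dots,I_m$ with $a$ preceding $b$ in both $\ell$ and $\hat\ell$ for all $a\in I_i$, $b\in I_j$, $i<j$. $\mathcal{IL}^m(2)$ is the set of $2$-multiple linear orders (of all sizes) with exactly $m$ irreducible parts. $\Psi(\ell,\hat\ell)=(\ell,\pi_{\hat\ell}\pi_\ell^{ -1})$. For a set $\mathcal B$ of permutations, $\mathrm{Lift}(\mathcal B)=\{(\ell,\pi_\ell\sigma\pi_\ell^{ -1}) : n\ge0,\ \ell\in\mathcal L_n,\ \sigma\in\mathcal B\text{ a permutation of }[n]\}$. -}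

module Defs where

open import Data.Nat using (ℕ; zero; suc; _≤_; _<_)
open import Data.Fin using (Fin; toℕ; inject₁) renaming (zero to fzero; suc to fsuc)
open import Data.Fin.Permutation using (Permutation′; _⟨$⟩ʳ_; _⟨$⟩ˡ_)
open import Data.Product using (Σ; _×_; ∃; ∃-syntax)
open import Relation.Binary.PropositionalEquality using (_≡_)

-- A permutation of [n] = {0,…,n-1} (represented by Fin n): a bijection Fin n → Fin n.
Perm : ℕ → Set
Perm n = Permutation′ n

_≈ₚ_ : ∀ {n} → Perm n → Perm n → Set
σ ≈ₚ τ = ∀ x → σ ⟨$⟩ʳ x ≡ τ ⟨$⟩ʳ x

-- A decomposition of [n] into m nonempty intervals of consecutive
-- integers I_1,…,I_m, given by cut points 0 = c₀ < c₁ < … < c_m = n;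
-- block j is the interval [c_j, c_{j+1}).
record IntervalDecomp (n m : ℕ) : Set where
  field
    cut      : Fin (suc m) → ℕ
    cut-0    : cut fzero ≡ 0
    cut-last : cut (Data.Fin.fromℕ m) ≡ n
    cut-<    : (j : Fin m) → cut (inject₁ j) < cut (fsuc j)

  InBlock : Fin m → Fin n → Set
  InBlock j x = (cut (inject₁ j) ≤ toℕ x) × (toℕ x < cut (fsuc j))

open IntervalDecomp public

MapsOnto : ∀ {n} → Perm n → (Fin n → Set) → Set
MapsOnto {n} σ I =
  (∀ x → I x → I (σ ⟨$⟩ʳ x)) × (∀ y → I y → ∃[ x ] (I x × (σ ⟨$⟩ʳ x ≡ y)))

HasIntervalDecomp : ∀ {n} → Perm n → ℕ → Set
HasIntervalDecomp {n} σ m =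
  Σ (IntervalDecomp n m) λ D → (j : Fin m) → MapsOnto σ (InBlock D j)

-- σ has exactly m indecomposable parts (m is the largest such number);
-- σ ∈ IP^(m)
IP : ℕ → ∀ {n} → Perm n → Set
IP m σ = HasIntervalDecomp σ m × (∀ k → HasIntervalDecomp σ k → k ≤ m)

-- A linear order ℓ = (ℓ₁ < … < ℓ_n) on [n] is represented by its
-- associated permutation π_ℓ : i ↦ ℓ_i (a bijection Fin n → Fin n).
LinOrd : ℕ → Set
LinOrd n = Perm n

π : ∀ {n} → LinOrd n → Fin n → Fin n
π ℓ i = ℓ ⟨$⟩ʳ i

Precedes : ∀ {n} → LinOrd n → Fin n → Fin n → Set
Precedes ℓ a b = toℕ (ℓ ⟨$⟩ˡ a) < toℕ (ℓ ⟨$⟩ˡ b)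

record IrredPartition {n} (ℓ ℓ̂ : LinOrd n) (m : ℕ) : Set where
  field
    blk      : Fin n → Fin m
    nonempty : (i : Fin m) → ∃[ x ] (blk x ≡ i)
    ordered  : ∀ a b → toℕ (blk a) < toℕ (blk b) →
               Precedes ℓ a b × Precedes ℓ̂ a b

IL2 : ℕ → ∀ {n} → LinOrd n → LinOrd n → Set
IL2 m ℓ ℓ̂ = IrredPartition ℓ ℓ̂ m × (∀ k → IrredPartition ℓ ℓ̂ k → k ≤ m)

-- Lift and Ψ, as membership predicates on pairs (ℓ, τ) ∈ 𝓛_n × S_n

conj : ∀ {n} → LinOrd n → Perm n → Fin n → Fin n
conj ℓ σ x = ℓ ⟨$⟩ʳ (σ ⟨$⟩ʳ (ℓ ⟨$⟩ˡ x))

ψ₂ : ∀ {n} → LinOrd n → LinOrd n → Fin n → Fin n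
ψ₂ ℓ ℓ̂ x = ℓ̂ ⟨$⟩ʳ (ℓ ⟨$⟩ˡ x)

InLift : (B : ∀ {n} → Perm n → Set) → ∀ {n} → LinOrd n → Perm n → Set
InLift B {n} ℓ τ =
  ∃[ ℓ′ ] ∃[ σ ] (B σ × (ℓ′ ≈ₚ ℓ) × (∀ x → conj ℓ′ σ x ≡ τ ⟨$⟩ʳ x))

InΨ : (A : ∀ {n} → LinOrd n → LinOrd n → Set) → ∀ {n} → LinOrd n → Perm n → Set
InΨ A {n} ℓ τ =
  ∃[ ℓ′ ] ∃[ ℓ̂ ] (A ℓ′ ℓ̂ × (ℓ′ ≈ₚ ℓ) × (∀ x → ψ₂ ℓ′ ℓ̂ x ≡ τ ⟨$⟩ʳ x))

-- Write π_ℓ̂ = π_ℓ σ. A decomposition of σ into k invariant intervals and an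
-- irreducible partition of (ℓ, ℓ̂) into k blocks are both the same thing as a
-- monotone surjection F : [n] → [k] with F ∘ σ = F: the blocks are its fibres,
-- and for a partition F = blk ∘ π_ℓ. The one non-formal step is that if both
-- blk ∘ π_ℓ and blk ∘ π_ℓ̂ = F ∘ σ are monotone then F ∘ σ = F; otherwise σ
-- would map some prefix {0,…,i} of [n] into the shorter prefix {0,…,i-1}.
-- Hence σ and (ℓ, ℓ̂) admit decompositions into exactly the same numbers of
-- parts, so their maximal numbers of parts agree.
module Submission where

open import Defs
open import Data.Nat using (ℕ; zero; suc; _≤_; _<_; z≤n; s≤s; s≤s⁻¹; _≤?_; _<?_)
open import Data.Nat.Properties
  using (≤-refl; ≤-reflexive; ≤-trans; ≤-antisym; <-≤-trans; ≤-<-trans; <⇒≤; <⇒≱; ≮⇒≥; ≰⇒>;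
         <-irrefl; n≤0⇒n≡0; 1+n≰n)
open import Data.Fin as Fin using (Fin; toℕ; inject₁; inject≤; fromℕ; fromℕ<)
  renaming (zero to fzero; suc to fsuc)
open import Data.Fin.Properties
  using (toℕ<n; toℕ-injective; toℕ-fromℕ; toℕ-fromℕ<; toℕ-inject₁; toℕ-inject≤;
         fromℕ<-injective; inject≤-injective; injective⇒≤; ≤fromℕ)
  renaming (≤-antisym to Fin-≤-antisym; <-cmp to Fin-<-cmp)
open import Data.Fin.Permutation using (_⟨$⟩ʳ_; _⟨$⟩ˡ_; inverseˡ; inverseʳ; _∘ₚ_; flip)
open import Data.Product using (_×_; _,_; proj₁; proj₂; Σ-syntax; ∃-syntax)
open import Function using (_∘_; _⇔_; mk⇔; Equivalence)
open import Function.Definitions using (Injective)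
import Function.Properties.Equivalence as ⇔
open import Level using (0ℓ)
open import Relation.Binary.Core using (_Preserves_⟶_)
open import Relation.Binary.Definitions using (tri<; tri≈; tri>)
open import Relation.Binary.PropositionalEquality
  using (_≡_; refl; sym; trans; cong; subst; subst₂)
open import Relation.Nullary using (¬_; yes; no; contradiction)
open import Relation.Unary using (Pred; Decidable)

open Equivalence using (to; from)

permutation-injective : ∀ {n} (σ : Perm n) → Injective _≡_ _≡_ (σ ⟨$⟩ʳ_)
permutation-injective σ σx≡σy =
  trans (sym (inverseˡ σ)) (trans (cong (σ ⟨$⟩ˡ_) σx≡σy) (inverseˡ σ))

Monotone : ∀ {n k} → (Fin n → Fin k) → Set
Monotone F = F Preserves Fin._≤_ ⟶ Fin._≤_

monotone-reflects-< : ∀ {n k} {F : Fin n → Fin k} → Monotone F →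
  ∀ {i j} → F i Fin.< F j → i Fin.< j
monotone-reflects-< monoF Fi<Fj = ≰⇒> (λ j≤i → <⇒≱ Fi<Fj (monoF j≤i))

injective-cannot-shrink-prefix : ∀ {n} (f : Fin n → Fin n) → Injective _≡_ _≡_ f →
  (i : Fin n) → ¬ (∀ k → k Fin.≤ i → f k Fin.< i)
injective-cannot-shrink-prefix {n} f f-injective i shrinks = 1+n≰n (injective⇒≤ g-injective)
  where
  embed : Fin (suc (toℕ i)) → Fin n
  embed k = inject≤ k (toℕ<n i)

  embed-≤ : ∀ k → embed k Fin.≤ i
  embed-≤ k = subst (_≤ toℕ i) (sym (toℕ-inject≤ k _)) (s≤s⁻¹ (toℕ<n k))

  g : Fin (suc (toℕ i)) → Fin (toℕ i)
  g k = fromℕ< (shrinks (embed k) (embed-≤ k))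

  g-injective : Injective _≡_ _≡_ g
  g-injective {a} {b} ga≡gb =
    inject≤-injective _ _ a b (f-injective (toℕ-injective (fromℕ<-injective _ _ _ _ ga≡gb)))

monotone-≤-∘perm : ∀ {n k} (σ : Perm n) {F G : Fin n → Fin k} →
  Monotone F → Monotone G → (∀ i → G i ≡ F (σ ⟨$⟩ʳ i)) → ∀ i → F i Fin.≤ G i
monotone-≤-∘perm σ {F} {G} monoF monoG G≡F∘σ i = ≮⇒≥ λ Gi<Fi →
  injective-cannot-shrink-prefix (σ ⟨$⟩ʳ_) (permutation-injective σ) i (σ-shrinks Gi<Fi)
  where
  σ-shrinks : G i Fin.< F i → ∀ k → k Fin.≤ i → σ ⟨$⟩ʳ k Fin.< i
  σ-shrinks Gi<Fi k k≤i = monotone-reflects-< monoF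
    (subst (Fin._< F i) (G≡F∘σ k) (≤-<-trans (monoG k≤i) Gi<Fi))

monotone-∘perm-invariant : ∀ {n k} (σ : Perm n) {F G : Fin n → Fin k} →
  Monotone F → Monotone G → (∀ i → G i ≡ F (σ ⟨$⟩ʳ i)) → ∀ i → F (σ ⟨$⟩ʳ i) ≡ F i
monotone-∘perm-invariant σ {F} {G} monoF monoG G≡F∘σ i =
  subst (_≡ F i) (G≡F∘σ i) (Fin-≤-antisym (G≤F i) (monotone-≤-∘perm σ monoF monoG G≡F∘σ i))
  where
  G≤F : ∀ i → G i Fin.≤ F i
  G≤F = monotone-≤-∘perm (flip σ) monoG monoF
          (λ j → trans (cong F (sym (inverseʳ σ))) (sym (G≡F∘σ (σ ⟨$⟩ˡ j))))

invariant⇒inverse-invariant : ∀ {n k} (σ : Perm n) {F : Fin n → Fin k} →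
  (∀ x → F (σ ⟨$⟩ʳ x) ≡ F x) → ∀ y → F (σ ⟨$⟩ˡ y) ≡ F y
invariant⇒inverse-invariant σ {F} F∘σ≡F y =
  trans (sym (F∘σ≡F (σ ⟨$⟩ˡ y))) (cong F (inverseʳ σ))

UpwardClosed : ∀ {n} → Pred (Fin n) 0ℓ → Set
UpwardClosed P = ∀ {x y} → x Fin.≤ y → P x → P y

record Threshold {n} (P : Pred (Fin n) 0ℓ) : Set where
  field
    value   : ℕ
    bounded : value ≤ n
    spec    : ∀ x → P x ⇔ value ≤ toℕ x

open Threshold

threshold : ∀ {n} {P : Pred (Fin n) 0ℓ} → Decidable P → UpwardClosed P → Threshold P
threshold {zero} P? P-up = record { value = 0 ; bounded = z≤n ; spec = λ () }
threshold {suc n} {P} P? P-up with P? fzero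
... | yes P0 =
  record { value = 0 ; bounded = z≤n ; spec = λ _ → mk⇔ (λ _ → z≤n) (λ _ → P-up z≤n P0) }
... | no ¬P0 =
  record { value = suc (value t) ; bounded = s≤s (bounded t) ; spec = spec′ }
  where
  t : Threshold (P ∘ fsuc)
  t = threshold (P? ∘ fsuc) (λ x≤y → P-up (s≤s x≤y))
  spec′ : ∀ x → P x ⇔ suc (value t) ≤ toℕ x
  spec′ fzero    = mk⇔ (λ P0 → contradiction P0 ¬P0) λ ()
  spec′ (fsuc x) = mk⇔ (s≤s ∘ to (spec t x)) (from (spec t x) ∘ s≤s⁻¹)

threshold-everywhere : ∀ {n} {P : Pred (Fin n) 0ℓ} (t : Threshold P) →
  (∀ x → P x) → value t ≡ 0
threshold-everywhere {zero}  t _   = n≤0⇒n≡0 (bounded t)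
threshold-everywhere {suc n} t all = n≤0⇒n≡0 (to (spec t fzero) (all fzero))

threshold-nowhere : ∀ {n} {P : Pred (Fin n) 0ℓ} (t : Threshold P) →
  (∀ x → ¬ P x) → value t ≡ n
threshold-nowhere t none = ≤-antisym (bounded t) (≮⇒≥ λ t<n →
  none (fromℕ< t<n) (from (spec t _) (≤-reflexive (sym (toℕ-fromℕ< t<n)))))

stepwise-increasing⇒monotone : ∀ {m} (c : Fin (suc m) → ℕ) →
  (∀ j → c (inject₁ j) < c (fsuc j)) → c Preserves Fin._≤_ ⟶ _≤_
stepwise-increasing⇒monotone c c-step {fzero} {fzero} _ = ≤-refl
stepwise-increasing⇒monotone {suc m} c c-step {fzero} {fsuc b} _ =
  ≤-trans (<⇒≤ (c-step fzero))
          (stepwise-increasing⇒monotone (c ∘ fsuc) (c-step ∘ fsuc) {fzero} {b} z≤n)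
stepwise-increasing⇒monotone {suc m} c c-step {fsuc a} {fsuc b} a≤b =
  stepwise-increasing⇒monotone (c ∘ fsuc) (c-step ∘ fsuc) (s≤s⁻¹ a≤b)

locate : ∀ {m} (c : Fin (suc m) → ℕ) {i} → c fzero ≤ i → i < c (fromℕ m) →
  ∃[ j ] c (inject₁ j) ≤ i × i < c (fsuc j)
locate {zero}  c c₀≤i i<cₘ = contradiction c₀≤i (<⇒≱ i<cₘ)
locate {suc m} c {i} c₀≤i i<cₘ with i <? c (fsuc fzero)
... | yes i<c₁ = fzero , c₀≤i , i<c₁
... | no i≮c₁ with locate (c ∘ fsuc) (≮⇒≥ i≮c₁) i<cₘ
...   | j , cⱼ≤i , i<cⱼ₊₁ = fsuc j , cⱼ≤i , i<cⱼ₊₁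

record MonotoneSurjection (n m : ℕ) : Set where
  field
    block      : Fin n → Fin m
    monotone   : Monotone block
    surjective : ∀ j → ∃[ x ] block x ≡ j

open MonotoneSurjection

_AreFibresOf_ : ∀ {n m} → (Fin m → Pred (Fin n) 0ℓ) → (Fin n → Fin m) → Set
B AreFibresOf F = ∀ j x → B j x ⇔ F x ≡ j

suc≤inject₁ : ∀ {m} {j j′ : Fin m} → j Fin.< j′ → fsuc j Fin.≤ inject₁ j′
suc≤inject₁ {j′ = j′} j<j′ = subst (_ ≤_) (sym (toℕ-inject₁ j′)) j<j′

module _ {n m} (D : IntervalDecomp n m) where
  private
    cut-monotone : cut D Preserves Fin._≤_ ⟶ _≤_
    cut-monotone = stepwise-increasing⇒monotone (cut D) (cut-< D)

    blockOf : (x : Fin n) → ∃[ j ] InBlock D j x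
    blockOf x = locate (cut D) (subst (_≤ toℕ x) (sym (cut-0 D)) z≤n)
                               (subst (toℕ x <_) (sym (cut-last D)) (toℕ<n x))

    InBlock-< : ∀ {j j′ x x′} → j Fin.< j′ → InBlock D j x → InBlock D j′ x′ → x Fin.< x′
    InBlock-< j<j′ (_ , x<cⱼ₊₁) (cⱼ′≤x′ , _) =
      <-≤-trans x<cⱼ₊₁ (≤-trans (cut-monotone (suc≤inject₁ j<j′)) cⱼ′≤x′)

    InBlock-unique : ∀ {j j′ x} → InBlock D j x → InBlock D j′ x → j ≡ j′
    InBlock-unique {j} {j′} x∈Iⱼ x∈Iⱼ′ with Fin-<-cmp j j′
    ... | tri< j<j′ _ _ = contradiction (InBlock-< j<j′ x∈Iⱼ x∈Iⱼ′) (<-irrefl refl)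
    ... | tri≈ _ j≡j′ _ = j≡j′
    ... | tri> _ _ j′<j = contradiction (InBlock-< j′<j x∈Iⱼ′ x∈Iⱼ) (<-irrefl refl)

    blockOf-fibres : InBlock D AreFibresOf (proj₁ ∘ blockOf)
    blockOf-fibres j x = mk⇔ (λ x∈Iⱼ → InBlock-unique (proj₂ (blockOf x)) x∈Iⱼ)
                             (λ { refl → proj₂ (blockOf x) })

    blockOf-monotone : Monotone (proj₁ ∘ blockOf)
    blockOf-monotone {x} {x′} x≤x′ = ≮⇒≥ λ j′<j →
      <⇒≱ (InBlock-< j′<j (proj₂ (blockOf x′)) (proj₂ (blockOf x))) x≤x′

    cutₗ<n : ∀ j → cut D (inject₁ j) < n
    cutₗ<n j = <-≤-trans (cut-< D j)
                 (subst (cut D (fsuc j) ≤_) (cut-last D) (cut-monotone (≤fromℕ (fsuc j))))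

    blockOf-surjective : ∀ j → ∃[ x ] proj₁ (blockOf x) ≡ j
    blockOf-surjective j = x , to (blockOf-fibres j x)
      (subst (λ v → cut D (inject₁ j) ≤ v × v < cut D (fsuc j))
             (sym (toℕ-fromℕ< (cutₗ<n j))) (≤-refl , cut-< D j))
      where
      x : Fin n
      x = fromℕ< (cutₗ<n j)

  decomp⇒surjection : Σ[ F ∈ MonotoneSurjection n m ] InBlock D AreFibresOf block F
  decomp⇒surjection =
      record { block = proj₁ ∘ blockOf ; monotone = blockOf-monotone ; surjective = blockOf-surjective }
    , blockOf-fibres

module _ {n m} (F : MonotoneSurjection n m) where
  private
    reaches : (j : Fin (suc m)) → Threshold (λ x → j Fin.≤ block F x)
    reaches j = threshold (λ x → toℕ j ≤? toℕ (block F x))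
                          (λ x≤y j≤Fx → ≤-trans j≤Fx (monotone F x≤y))

    c : Fin (suc m) → ℕ
    c j = value (reaches j)

    between⇔fibre : ∀ j x → (c (inject₁ j) ≤ toℕ x × toℕ x < c (fsuc j)) ⇔ block F x ≡ j
    between⇔fibre j x = mk⇔
      (λ (cⱼ≤x , x<cⱼ₊₁) → Fin-≤-antisym
        (s≤s⁻¹ (≰⇒> λ j<Fx → <⇒≱ x<cⱼ₊₁ (to (spec (reaches (fsuc j)) x) j<Fx)))
        (subst (_≤ toℕ (block F x)) (toℕ-inject₁ j) (from (spec (reaches (inject₁ j)) x) cⱼ≤x)))
      (λ { refl → to (spec (reaches (inject₁ j)) x) (≤-reflexive (toℕ-inject₁ j))
                , ≰⇒> λ cⱼ₊₁≤x → 1+n≰n (from (spec (reaches (fsuc j)) x) cⱼ₊₁≤x) })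

    c-0 : c fzero ≡ 0
    c-0 = threshold-everywhere (reaches fzero) (λ _ → z≤n)

    c-last : c (fromℕ m) ≡ n
    c-last = threshold-nowhere (reaches (fromℕ m)) λ x m≤Fx →
      <⇒≱ (toℕ<n (block F x)) (subst (_≤ toℕ (block F x)) (toℕ-fromℕ m) m≤Fx)

    c-< : ∀ j → c (inject₁ j) < c (fsuc j)
    c-< j with surjective F j
    ... | x , Fx≡j = let (cⱼ≤x , x<cⱼ₊₁) = from (between⇔fibre j x) Fx≡j in
                     ≤-<-trans cⱼ≤x x<cⱼ₊₁

  surjection⇒decomp : Σ[ D ∈ IntervalDecomp n m ] InBlock D AreFibresOf block F
  surjection⇒decomp =
    record { cut = c ; cut-0 = c-0 ; cut-last = c-last ; cut-< = c-< } , between⇔fibre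

mapsOnto-fibres⇔invariant : ∀ {n m} (σ : Perm n) {B : Fin m → Pred (Fin n) 0ℓ}
  {F : Fin n → Fin m} → B AreFibresOf F →
  (∀ j → MapsOnto σ (B j)) ⇔ (∀ x → F (σ ⟨$⟩ʳ x) ≡ F x)
mapsOnto-fibres⇔invariant σ {B} {F} fibres = mk⇔ invariant mapsOnto
  where
  invariant : (∀ j → MapsOnto σ (B j)) → ∀ x → F (σ ⟨$⟩ʳ x) ≡ F x
  invariant σBⱼ⊆Bⱼ x =
    to (fibres (F x) _) (proj₁ (σBⱼ⊆Bⱼ (F x)) x (from (fibres (F x) x) refl))

  mapsOnto : (∀ x → F (σ ⟨$⟩ʳ x) ≡ F x) → ∀ j → MapsOnto σ (B j)
  mapsOnto F∘σ≡F j =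
      (λ x x∈Bⱼ → from (fibres j _) (trans (F∘σ≡F x) (to (fibres j x) x∈Bⱼ)))
    , (λ y y∈Bⱼ → σ ⟨$⟩ˡ y
                , from (fibres j _)
                    (trans (invariant⇒inverse-invariant σ F∘σ≡F y) (to (fibres j y) y∈Bⱼ))
                , inverseʳ σ)

InvariantBlockMap : ∀ {n} → Perm n → ℕ → Set
InvariantBlockMap {n} σ m =
  Σ[ F ∈ MonotoneSurjection n m ] (∀ x → block F (σ ⟨$⟩ʳ x) ≡ block F x)

intervalDecomp⇔invariantBlockMap : ∀ {n} (σ : Perm n) m →
  HasIntervalDecomp σ m ⇔ InvariantBlockMap σ m
intervalDecomp⇔invariantBlockMap σ m = mk⇔
  (λ (D , maps) → let (F , fibres) = decomp⇒surjection D in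
                   F , to (mapsOnto-fibres⇔invariant σ fibres) maps)
  (λ (F , invariant) → let (D , fibres) = surjection⇒decomp F in
                        D , from (mapsOnto-fibres⇔invariant σ fibres) invariant)

ordered⇒monotone : ∀ {n m} (ℓ : LinOrd n) (blk : Fin n → Fin m) →
  (∀ a b → blk a Fin.< blk b → Precedes ℓ a b) → Monotone (blk ∘ π ℓ)
ordered⇒monotone ℓ blk ordered i≤i′ = ≮⇒≥ λ Fi′<Fi →
  <⇒≱ (subst₂ Fin._<_ (inverseˡ ℓ) (inverseˡ ℓ) (ordered _ _ Fi′<Fi)) i≤i′

module _ {n} (ℓ ℓ̂ : LinOrd n) (σ : Perm n)
         (ℓ̂≡ℓ∘σ : ∀ i → ℓ̂ ⟨$⟩ʳ i ≡ ℓ ⟨$⟩ʳ (σ ⟨$⟩ʳ i)) where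
  private
    ℓ̂⁻¹≡σ⁻¹∘ℓ⁻¹ : ∀ a → ℓ̂ ⟨$⟩ˡ a ≡ σ ⟨$⟩ˡ (ℓ ⟨$⟩ˡ a)
    ℓ̂⁻¹≡σ⁻¹∘ℓ⁻¹ a = permutation-injective ℓ̂
      (trans (inverseʳ ℓ̂)
             (sym (trans (ℓ̂≡ℓ∘σ _) (trans (cong (ℓ ⟨$⟩ʳ_) (inverseʳ σ)) (inverseʳ ℓ)))))

    partition⇒blockMap : ∀ {m} → IrredPartition ℓ ℓ̂ m → InvariantBlockMap σ m
    partition⇒blockMap {m} P =
      F , monotone-∘perm-invariant σ monoF monoG (λ i → cong blk (ℓ̂≡ℓ∘σ i))
      where
      open IrredPartition P
      monoF : Monotone (blk ∘ π ℓ)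
      monoF = ordered⇒monotone ℓ blk (λ a b → proj₁ ∘ ordered a b)
      monoG : Monotone (blk ∘ π ℓ̂)
      monoG = ordered⇒monotone ℓ̂ blk (λ a b → proj₂ ∘ ordered a b)
      F : MonotoneSurjection n m
      F = record { block = blk ∘ π ℓ ; monotone = monoF
                 ; surjective = λ j → let (x , blkx≡j) = nonempty j in
                                       ℓ ⟨$⟩ˡ x , trans (cong blk (inverseʳ ℓ)) blkx≡j }

    blockMap⇒partition : ∀ {m} → InvariantBlockMap σ m → IrredPartition ℓ ℓ̂ m
    blockMap⇒partition (F , F∘σ≡F) = record
      { blk      = block F ∘ (ℓ ⟨$⟩ˡ_)
      ; nonempty = λ j → let (i , Fi≡j) = surjective F j in
                         ℓ ⟨$⟩ʳ i , trans (cong (block F) (inverseˡ ℓ)) Fi≡j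
      ; ordered  = λ a b lt →
          monotone-reflects-< (monotone F) lt
        , subst₂ Fin._<_ (sym (ℓ̂⁻¹≡σ⁻¹∘ℓ⁻¹ a)) (sym (ℓ̂⁻¹≡σ⁻¹∘ℓ⁻¹ b))
            (monotone-reflects-< (monotone F)
              (subst₂ Fin._<_ (sym (F∘σ⁻¹≡F _)) (sym (F∘σ⁻¹≡F _)) lt))
      }
      where
      F∘σ⁻¹≡F : ∀ y → block F (σ ⟨$⟩ˡ y) ≡ block F y
      F∘σ⁻¹≡F = invariant⇒inverse-invariant σ F∘σ≡F

  intervalDecomp⇔irredPartition : ∀ m → HasIntervalDecomp σ m ⇔ IrredPartition ℓ ℓ̂ m
  intervalDecomp⇔irredPartition m =
    ⇔.trans (intervalDecomp⇔invariantBlockMap σ m) (mk⇔ blockMap⇒partition partition⇒blockMap)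

greatest-resp-⇔ : {P Q : ℕ → Set} → (∀ k → P k ⇔ Q k) →
  ∀ m → P m × (∀ k → P k → k ≤ m) → Q m × (∀ k → Q k → k ≤ m)
greatest-resp-⇔ P⇔Q m (Pm , maximal) =
  to (P⇔Q m) Pm , λ k Qk → maximal k (from (P⇔Q k) Qk)

lemma4p4 : (m : ℕ) → 1 ≤ m → (n : ℕ) (ℓ : LinOrd n) (τ : Perm n) →
    (InLift (IP m) ℓ τ → InΨ (IL2 m) ℓ τ) × (InΨ (IL2 m) ℓ τ → InLift (IP m) ℓ τ)
lemma4p4 m _ n ℓ τ = lift⇒Ψ , Ψ⇒lift
  where
  lift⇒Ψ : InLift (IP m) ℓ τ → InΨ (IL2 m) ℓ τ
  lift⇒Ψ (ℓ′ , σ , σ∈IP , ℓ′≈ℓ , conj≡τ) =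
      ℓ′ , σ ∘ₚ ℓ′
    , greatest-resp-⇔ (intervalDecomp⇔irredPartition ℓ′ (σ ∘ₚ ℓ′) σ (λ _ → refl)) m σ∈IP
    , ℓ′≈ℓ , conj≡τ

  Ψ⇒lift : InΨ (IL2 m) ℓ τ → InLift (IP m) ℓ τ
  Ψ⇒lift (ℓ′ , ℓ̂ , ℓ̂∈IL , ℓ′≈ℓ , ψ≡τ) =
      ℓ′ , σ
    , greatest-resp-⇔ (⇔.sym ∘ intervalDecomp⇔irredPartition ℓ′ ℓ̂ σ (λ _ → sym (inverseʳ ℓ′)))
                      m ℓ̂∈IL
    , ℓ′≈ℓ , λ x → trans (inverseʳ ℓ′) (ψ≡τ x)
    where
    σ : Perm n
    σ = ℓ̂ ∘ₚ flip ℓ′
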